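{- Let $n\ge 3$ and consider the poset of circular permutations of $S_n$. Label each edge of its Hasse diagram, from $\sigma'$ to a circular permutation $\tau'$ covering it, by the transposition $(r,s)$ with $r+1<s$ such that $\sigma'$ has the circular factor $sr$ and $\tau'$ is obtained from it by replacing this factor with $rs$ (so $\tau'=(r,s)\circ\sigma'\circ(r,s)$). Given circular permutations $\sigma\le\tau$ and an upward path in the Hasse diagram from $\sigma$ to $\tau$ with successive labels $(r_1,s_1),\ldots,(r_p,s_p)$, let $\alpha=(r_p,s_p)\circ\cdots\circ(r_1,s_1)\in S_n$, so that $\tau=\alpha\circ\sigma\circ\alpha^{ -1}$. Then $\alpha$ depends only on $\sigma$ and $\tau$ and not on the chosen path. Moreover, for a maximal path (from $\sigma=(1\,2\cdots n)$ to $\tau=(n\cdots 2\,1)$), one has, writing permutations as words $\alpha(1)\alpha(2)\cdots\alpha(n)$: $\alpha=n\cdots 2\,1$ if $n$ is odd, and $\alpha=(n/2)\cdots 2\,1\,n\cdots(1+n/2)$ if $n$ is even.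
   Context: Permutations of $\{1,\dots,n\}$ are viewed as words; a circular factor of a word $w$ is a contiguous factor of some cyclic rotation $yx$ of $w=xy$. A circular permutation is an $n$-cycle in $S_n$; $(w)$ denotes the $n$-cycle $w_1\mapsto w_2\mapsto\cdots\mapsto w_n\mapsto w_1$. The poset of circular permutations is ordered by the reflexive transitive closure of the relation $(w)\to(w')$, which holds when $w$ has a circular factor $sr$ with $s>r+1$ and $w'$ is obtained from $w$ by replacing this factor by $rs$; its covering relations are exactly the steps of $\to$. -}

module Defs where

open import Data.Nat using (ℕ; zero; suc; _+_; _<_)
open import Data.Fin using (Fin; toℕ; _≟_)
open import Data.Fin.Permutation.Components using (transpose)
open import Data.List using (List; []; _∷_; _++_; allFin; map)
open import Data.List.Relation.Binary.Permutation.Propositional using (_↭_)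
open import Data.Product using (Σ; ∃; _×_)
open import Data.Bool using (if_then_else_)
open import Relation.Nullary using (does)
open import Relation.Binary.PropositionalEquality using (_≡_)

-- Convention: the values 1..n of the paper are encoded by Fin n (value k ↦ k-1).
-- A circular permutation is handled through its map Fin n → Fin n.

cycGo : ∀ {n} → Fin n → List (Fin n) → Fin n → Fin n
cycGo h []           x = x
cycGo h (y ∷ [])     x = if does (y ≟ x) then h else x
cycGo h (y ∷ z ∷ zs) x = if does (y ≟ x) then z else cycGo h (z ∷ zs) x

-- (w) : the cycle w₁ ↦ w₂ ↦ ⋯ ↦ wₙ ↦ w₁ (identity off the letters of w).
cyc : ∀ {n} → List (Fin n) → Fin n → Fin n
cyc []      x = x
cyc (h ∷ t) x = cycGo h (h ∷ t) x

PermWord : ∀ {n} → List (Fin n) → Set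
PermWord {n} w = w ↭ allFin n

-- Labelled edge of the Hasse diagram, from σ to τ, with label (r,s), r+1<s:
-- some word w = u·sr·v of σ (i.e. (w) = σ; every circular factor of a word is a
-- factor of one of its rotations, all of which represent the same cycle)
-- and τ = (u·rs·v).
Step : ∀ {n} → Fin n → Fin n → (Fin n → Fin n) → (Fin n → Fin n) → Set
Step {n} r s σ τ =
  suc (toℕ r) < toℕ s ×
  Σ (List (Fin n)) λ u → Σ (List (Fin n)) λ v →
    PermWord (u ++ s ∷ r ∷ v) ×
    (∀ i → σ i ≡ cyc (u ++ s ∷ r ∷ v) i) ×
    (∀ i → τ i ≡ cyc (u ++ r ∷ s ∷ v) i)

data Path {n : ℕ} : (Fin n → Fin n) → (Fin n → Fin n) → Set where
  []   : ∀ {σ} → Path σ σ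
  step : ∀ {σ ρ τ} (r s : Fin n) → Step r s σ ρ → Path ρ τ → Path σ τ

alpha : ∀ {n} {σ τ : Fin n → Fin n} → Path σ τ → Fin n → Fin n
alpha []               i = i
alpha (step r s _ p)   i = alpha p (transpose r s i)

alphaWord : ∀ {n} {σ τ : Fin n → Fin n} → Path σ τ → List ℕ
alphaWord {n} p = map (λ i → suc (toℕ (alpha p i))) (allFin n)

module Submission where

-- Read the cycle of a circular permutation σ starting just after the letter n; the
-- resulting word of length n − 1 has an inverse major index E(σ).  A covering step
-- (r,s) with s ≠ n swaps two non-consecutive letters of that word and leaves E
-- unchanged; a step with s = n moves r from the front of the word to its end, which
-- raises E by exactly one because r + 1 lies in the word and r − 1 (if any) does too.
-- Consequently α, for any path from σ to τ, conjugates σ to τ and sends σᵏ(n) to n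
-- where k = E(τ) − E(σ); as σ is an n-cycle these two properties determine α.
-- For the maximal path E(1 2 ⋯ n) = 0 and E(n ⋯ 2 1) = C(n−1,2), so the letter sent
-- to n is the residue of C(n−1,2) mod n, namely 1 for n odd and n/2 + 1 for n even,
-- and α maps the cycle word of (1 2 ⋯ n) read from that letter onto n (n−1) ⋯ 1.

open import Defs
open import Function using (_∘_; _∘′_)
open import Function.Bundles using (_⇔_; mk⇔)
open import Data.Empty using (⊥-elim)
open import Data.Bool using (if_then_else_)
open import Data.Bool.Properties using (if-float)
open import Data.Nat using (ℕ; zero; suc; _+_; _*_; _≤_; _<_; s≤s)
import Data.Nat.Properties as ℕ
open import Algebra.Properties.CommutativeSemigroup ℕ.+-commutativeSemigroup using (x∙yz≈y∙xz)
open import Data.Nat.Combinatorics using (_C_; nC1≡n; nCk+nC[k+1]≡[n+1]C[k+1])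
open import Data.Nat.GeneralisedArithmetic using (iterate)
open import Data.Nat.Tactic.RingSolver using (solve-∀)
open import Data.Fin using (Fin; zero; suc; toℕ; fromℕ; fromℕ<; inject₁; _≟_)
open import Data.Fin.Properties using (toℕ-injective; toℕ-fromℕ; toℕ-fromℕ<; toℕ<n; toℕ-inject₁)
open import Data.Fin.Permutation.Components using (transpose; transpose-inverse)
open import Data.List
  using (List; []; _∷_; _++_; [_]; _∷ʳ_; map; length; allFin; tabulate; reverse;
         upTo; applyUpTo; downFrom; applyDownFrom)
open import Data.List.Properties
  using (++-assoc; ++-identityʳ; ∷-injective; map-++; map-∘; map-id-local; map-tabulate;
         tabulate-cong; length-++; length-map; length-tabulate; length-applyDownFrom;
         length-reverse; reverse-map; reverse-++; reverse-applyUpTo; reverse-upTo)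
open import Data.List.Membership.Propositional using (_∈_; _∉_)
open import Data.List.Membership.DecPropositional ℕ._≟_ using (_∈?_)
open import Data.List.Membership.Propositional.Properties
  using (∈-++⁺ˡ; ∈-++⁺ʳ; ∈-++⁻; ∈-∃++; ∈-map⁺; ∈-allFin; ∈-downFrom⁺)
open import Data.List.Relation.Unary.Any using (here; there)
open import Data.List.Relation.Unary.All using (All)
import Data.List.Relation.Unary.All as All
open import Data.List.Relation.Unary.AllPairs using (AllPairs; []; _∷_)
open import Data.List.Relation.Unary.AllPairs.Properties using (applyUpTo⁺₁)
open import Data.List.Relation.Unary.Unique.Propositional using (Unique)
import Data.List.Relation.Unary.Unique.Propositional.Properties as Unique
open import Data.List.Relation.Binary.Permutation.Propositional
  using (_↭_; ↭-refl; ↭-sym; ↭-trans; swap; ↭⇒↭ₛ)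
open import Data.List.Relation.Binary.Permutation.Propositional.Properties
  using (∈-resp-↭; ↭-length; ↭-reverse; ++-comm; ++⁺ˡ; shift)
import Data.List.Relation.Binary.Permutation.Setoid.Properties as ↭ₛ
open import Data.Product using (∃; ∃-syntax; _×_; _,_; proj₁; proj₂)
open import Data.Sum using (inj₁; inj₂; [_,_]′)
open import Relation.Nullary using (Dec; yes; no; does)
open import Relation.Nullary.Decidable using (dec-true; dec-false; does-⇔)
open import Relation.Binary.PropositionalEquality hiding ([_])
open ≡-Reasoning

private
  variable
    A B : Set

iterate-suc : ∀ (f : A → A) x k → iterate f x (suc k) ≡ f (iterate f x k)
iterate-suc f x zero    = refl
iterate-suc f x (suc k) = iterate-suc f (f x) k

iterate-+ : ∀ (f : A → A) x p q → iterate f x (p + q) ≡ iterate f (iterate f x p) q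
iterate-+ f x zero    q = refl
iterate-+ f x (suc p) q = iterate-+ f (f x) p q

orbit : (A → A) → ℕ → A → List A
orbit f zero    x = []
orbit f (suc k) x = f x ∷ orbit f k (f x)

orbit-+ : ∀ (f : A → A) p q x → orbit f (p + q) x ≡ orbit f p x ++ orbit f q (iterate f x p)
orbit-+ f zero    q x = refl
orbit-+ f (suc p) q x = cong (f x ∷_) (orbit-+ f p q (f x))

∈-orbit⇒iterate : ∀ {f : A → A} k {x y} → y ∈ orbit f k x → ∃ λ j → iterate f x j ≡ y
∈-orbit⇒iterate (suc k) (here refl) = 1 , refl
∈-orbit⇒iterate (suc k) (there y∈) with ∈-orbit⇒iterate k y∈
... | j , eq = suc j , eq

module _ {f : A → A} {g : B → B} {h : A → B} (h∘f≗g∘h : ∀ x → h (f x) ≡ g (h x)) where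

  iterate-conj : ∀ k x → iterate g (h x) k ≡ h (iterate f x k)
  iterate-conj zero    x = refl
  iterate-conj (suc k) x =
    trans (cong (λ y → iterate g y k) (sym (h∘f≗g∘h x))) (iterate-conj k (f x))

  orbit-conj : ∀ k x → map h (orbit f k x) ≡ orbit g k (h x)
  orbit-conj zero    x = refl
  orbit-conj (suc k) x =
    cong₂ _∷_ (h∘f≗g∘h x) (trans (orbit-conj k (f x)) (cong (orbit g k) (h∘f≗g∘h x)))

Unique-resp-↭ : ∀ {xs ys : List A} → xs ↭ ys → Unique xs → Unique ys
Unique-resp-↭ xs↭ys = ↭ₛ.Unique-resp-↭ (setoid _) (↭⇒↭ₛ xs↭ys)

∉-rest : ∀ (P : List A) {x Q} → Unique (P ++ x ∷ Q) → x ∉ P ++ Q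
∉-rest P {x} {Q} uniq x∈ with Unique-resp-↭ (shift x P Q) uniq
... | x∉ ∷ _ = All.lookup x∉ x∈ refl

splitAt-length : ∀ (xs : List A) a b → length xs ≡ a + suc b →
                 ∃[ P ] ∃[ x ] ∃[ Q ] xs ≡ P ++ x ∷ Q × length P ≡ a × length Q ≡ b
splitAt-length (x ∷ xs) zero    b eq = [] , x , xs , refl , refl , ℕ.suc-injective eq
splitAt-length (y ∷ xs) (suc a) b eq with splitAt-length xs a b (ℕ.suc-injective eq)
... | P , x , Q , refl , refl , refl = y ∷ P , x , Q , refl , refl , refl

++-injective-length : ∀ (xs ys : List A) {us vs} → length xs ≡ length ys →
                      xs ++ us ≡ ys ++ vs → xs ≡ ys × us ≡ vs
++-injective-length []       []       _   eq = refl , eq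
++-injective-length (x ∷ xs) (y ∷ ys) len eq with ∷-injective eq
... | refl , eq′ with ++-injective-length xs ys (ℕ.suc-injective len) eq′
...   | refl , refl = refl , refl

applyDownFrom-+ : ∀ a b → applyDownFrom suc (b + a) ≡
                  applyDownFrom (λ i → a + suc i) b ++ applyDownFrom suc a
applyDownFrom-+ a zero    = refl
applyDownFrom-+ a (suc b) =
  cong₂ _∷_ (sym (trans (ℕ.+-suc a b) (cong suc (ℕ.+-comm a b)))) (applyDownFrom-+ a b)

tabulate-∷ʳ : ∀ {m} (f : Fin (suc m) → A) → tabulate f ≡ tabulate (f ∘ inject₁) ∷ʳ f (fromℕ m)
tabulate-∷ʳ {m = zero}  f = refl
tabulate-∷ʳ {m = suc m} f = cong (f zero ∷_) (tabulate-∷ʳ (f ∘ suc))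

tabulate-toℕ : ∀ (f : ℕ → A) n → tabulate (f ∘ toℕ {n}) ≡ applyUpTo f n
tabulate-toℕ f zero    = refl
tabulate-toℕ f (suc n) = cong (f 0 ∷_) (tabulate-toℕ (f ∘ suc) n)

map-allFin : ∀ (f : ℕ → A) n → map (f ∘ toℕ) (allFin n) ≡ applyUpTo f n
map-allFin f n = trans (map-tabulate (λ i → i) (f ∘ toℕ)) (tabulate-toℕ f n)

map-reverse-allFin : ∀ (f : ℕ → A) n → map (f ∘ toℕ) (reverse (allFin n)) ≡ applyDownFrom f n
map-reverse-allFin f n =
  trans (reverse-map (f ∘ toℕ) (allFin n)) (trans (cong reverse (map-allFin f n)) (reverse-applyUpTo f n))

module _ {n : ℕ} where

  transpose-matchˡ : (r s : Fin n) → transpose r s r ≡ s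
  transpose-matchˡ r s rewrite dec-true (r ≟ r) refl = refl

  transpose-matchʳ : (r s : Fin n) → transpose r s s ≡ r
  transpose-matchʳ r s with s ≟ r
  ... | yes s≡r = s≡r
  ... | no _ rewrite dec-true (s ≟ s) refl = refl

  transpose-fix : ∀ {r s x : Fin n} → x ≢ r → x ≢ s → transpose r s x ≡ x
  transpose-fix {r} {s} {x} x≢r x≢s rewrite dec-false (x ≟ r) x≢r | dec-false (x ≟ s) x≢s = refl

  transpose-injective : ∀ (r s : Fin n) {x y} → transpose r s x ≡ transpose r s y → x ≡ y
  transpose-injective r s eq =
    trans (sym (transpose-inverse s r)) (trans (cong (transpose s r) eq) (transpose-inverse s r))

  cycGo-skip : ∀ {h a x : Fin n} P Q → a ≢ x → cycGo h (a ∷ P ++ x ∷ Q) x ≡ cycGo h (P ++ x ∷ Q) x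
  cycGo-skip {a = a} {x} []      Q a≢x rewrite dec-false (a ≟ x) a≢x = refl
  cycGo-skip {a = a} {x} (_ ∷ P) Q a≢x rewrite dec-false (a ≟ x) a≢x = refl

  cycGo-next : ∀ {h x y : Fin n} P Q → x ∉ P → cycGo h (P ++ x ∷ y ∷ Q) x ≡ y
  cycGo-next {x = x} [] Q _ rewrite dec-true (x ≟ x) refl = refl
  cycGo-next (a ∷ P) Q x∉ =
    trans (cycGo-skip P _ (λ a≡x → x∉ (here (sym a≡x)))) (cycGo-next P Q (x∉ ∘′ there))

  cycGo-last : ∀ {h x : Fin n} P → x ∉ P → cycGo h (P ++ [ x ]) x ≡ h
  cycGo-last {x = x} [] _ rewrite dec-true (x ≟ x) refl = refl
  cycGo-last (a ∷ P) x∉ =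
    trans (cycGo-skip P [] (λ a≡x → x∉ (here (sym a≡x)))) (cycGo-last P (x∉ ∘′ there))

  cyc-next : ∀ {x y : Fin n} P Q → x ∉ P → cyc (P ++ x ∷ y ∷ Q) x ≡ y
  cyc-next []      = cycGo-next []
  cyc-next (a ∷ P) = cycGo-next (a ∷ P)

  cyc-last : ∀ {a x : Fin n} P → x ∉ a ∷ P → cyc (a ∷ P ++ [ x ]) x ≡ a
  cyc-last {a} P = cycGo-last (a ∷ P)

  cyc-singleton : (x : Fin n) → cyc [ x ] x ≡ x
  cyc-singleton x rewrite dec-true (x ≟ x) refl = refl

  module _ {f : Fin n → Fin n} (f-inj : ∀ {x y} → f x ≡ f y → x ≡ y) where

    does-f≟f : ∀ x y → does (f x ≟ f y) ≡ does (x ≟ y)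
    does-f≟f x y with x ≟ y
    ... | yes refl = dec-true (f x ≟ f x) refl
    ... | no x≢y   = dec-false (f x ≟ f y) (x≢y ∘′ f-inj)

    cycGo-map : ∀ h w x → cycGo (f h) (map f w) (f x) ≡ f (cycGo h w x)
    cycGo-map h []           x = refl
    cycGo-map h (y ∷ [])     x rewrite does-f≟f y x = sym (if-float f (does (y ≟ x)))
    cycGo-map h (y ∷ z ∷ zs) x =
      trans (cong₂ (λ b c → if b then f z else c) (does-f≟f y x) (cycGo-map h (z ∷ zs) x))
            (sym (if-float f (does (y ≟ x))))

    cyc-map : ∀ w x → cyc (map f w) (f x) ≡ f (cyc w x)
    cyc-map []      x = refl
    cyc-map (h ∷ w) x = cycGo-map h (h ∷ w) x

record CycleWord {n} (σ : Fin n → Fin n) (W : List (Fin n)) : Set where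
  field
    distinct : Unique W
    cyc≗     : ∀ i → σ i ≡ cyc W i

module _ {n} {σ : Fin n → Fin n} {W : List (Fin n)} (w : CycleWord σ W) where
  open CycleWord w

  cycleWord-next : ∀ P {x y} Q → W ≡ P ++ x ∷ y ∷ Q → σ x ≡ y
  cycleWord-next P Q refl = trans (cyc≗ _) (cyc-next P Q (∉-rest P distinct ∘′ ∈-++⁺ˡ))

  cycleWord-wrap : ∀ {h} T P {x} → W ≡ h ∷ T → W ≡ P ++ [ x ] → σ x ≡ h
  cycleWord-wrap _ []      refl refl = trans (cyc≗ _) (cyc-singleton _)
  cycleWord-wrap _ (a ∷ P) refl refl = trans (cyc≗ _) (cyc-last P (∉-rest (a ∷ P) distinct ∘′ ∈-++⁺ˡ))

  iterate-walk : ∀ P {x} Q {y} R → W ≡ P ++ x ∷ Q ++ y ∷ R → iterate σ x (suc (length Q)) ≡ y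
  iterate-walk P []      R eq = cycleWord-next P R eq
  iterate-walk P (b ∷ Q) R eq =
    trans (cong (λ z → iterate σ z (suc (length Q))) (cycleWord-next P _ eq))
          (iterate-walk (P ++ [ _ ]) Q R (trans eq (sym (++-assoc P [ _ ] _))))

  orbit-walk : ∀ P {x} Q R → W ≡ P ++ x ∷ Q ++ R → orbit σ (length Q) x ≡ Q
  orbit-walk P []      R eq = refl
  orbit-walk P (b ∷ Q) R eq rewrite cycleWord-next P _ eq =
    cong (b ∷_) (orbit-walk (P ++ [ _ ]) Q R (trans eq (sym (++-assoc P [ _ ] _))))

  iterate-wrap : ∀ {a} P {x} Q → W ≡ a ∷ P ++ x ∷ Q → iterate σ x (suc (length Q)) ≡ a
  iterate-wrap P []      eq = cycleWord-wrap _ (_ ∷ P) eq eq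
  iterate-wrap P (b ∷ Q) eq =
    trans (cong (λ z → iterate σ z (suc (length Q))) (cycleWord-next (_ ∷ P) Q eq))
          (iterate-wrap (P ++ [ _ ]) Q (trans eq (cong (_ ∷_) (sym (++-assoc P [ _ ] _)))))

  iterate-period : ∀ {x} Q → W ≡ x ∷ Q → iterate σ x (suc (length Q)) ≡ x
  iterate-period []      eq = cycleWord-wrap [] [] eq eq
  iterate-period (b ∷ Q) eq =
    trans (cong (λ z → iterate σ z (suc (length Q))) (cycleWord-next [] Q eq)) (iterate-wrap [] Q eq)

  iterate-position : ∀ {h} T P {x} Q → W ≡ h ∷ T → W ≡ P ++ x ∷ Q → iterate σ h (length P) ≡ x
  iterate-position T []      Q refl refl = refl
  iterate-position T (a ∷ P) Q refl refl = iterate-walk [] P Q refl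

  orbit-from : ∀ {x} Q → W ≡ x ∷ Q → orbit σ (length Q) x ≡ Q
  orbit-from {x} Q eq = orbit-walk [] Q [] (trans eq (cong (x ∷_) (sym (++-identityʳ Q))))

  orbit-rotation : ∀ P {x} Q → W ≡ P ++ x ∷ Q → orbit σ (length Q + length P) x ≡ Q ++ P
  orbit-rotation P {x} Q eq = begin
    orbit σ (length Q + length P) x                              ≡⟨ orbit-+ σ (length Q) (length P) x ⟩
    orbit σ (length Q) x ++ orbit σ (length P) (iterate σ x (length Q))
      ≡⟨ cong₂ _++_ (orbit-walk P Q [] (trans eq (cong (λ R → P ++ x ∷ R) (sym (++-identityʳ Q)))))
                    (around P eq) ⟩
    Q ++ P                                                       ∎
    where
    around : ∀ P → W ≡ P ++ x ∷ Q → orbit σ (length P) (iterate σ x (length Q)) ≡ P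
    around []      eq = refl
    around (a ∷ P) eq =
      cong₂ _∷_ σz≡a (trans (cong (orbit σ (length P)) σz≡a) (orbit-walk [] P (x ∷ Q) eq))
      where
      σz≡a : σ (iterate σ x (length Q)) ≡ a
      σz≡a = trans (sym (iterate-suc σ x (length Q))) (iterate-wrap P Q eq)

  iterate-reaches : ∀ {x y} → x ∈ W → y ∈ W → ∃ λ j → iterate σ x j ≡ y
  iterate-reaches x∈ y∈ with ∈-∃++ x∈
  ... | P , Q , refl with ∈-resp-↭ (shift _ P Q) y∈
  ...   | here refl = 0 , refl
  ...   | there y∈′ = ∈-orbit⇒iterate (length Q + length P)
            (subst (_ ∈_) (sym (orbit-rotation P Q refl)) (∈-resp-↭ (++-comm P Q) y∈′))

module _ {n : ℕ} {W : List (Fin n)} (W↭ : PermWord W) where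

  PermWord-unique : Unique W
  PermWord-unique = Unique-resp-↭ (↭-sym W↭) (Unique.allFin⁺ n)

  PermWord-∈ : ∀ x → x ∈ W
  PermWord-∈ x = ∈-resp-↭ (↭-sym W↭) (∈-allFin x)

  PermWord-length : length W ≡ n
  PermWord-length = trans (↭-length W↭) (length-tabulate (λ i → i))

  PermWord-cycleWord : ∀ {σ} → (∀ i → σ i ≡ cyc W i) → CycleWord σ W
  PermWord-cycleWord σ≗ = record { distinct = PermWord-unique ; cyc≗ = σ≗ }

PermWord-swap : ∀ {n} {r s : Fin n} u v → PermWord (u ++ s ∷ r ∷ v) → PermWord (u ++ r ∷ s ∷ v)
PermWord-swap u v W↭ = ↭-trans (++⁺ˡ u (swap _ _ ↭-refl)) W↭

transpose-word : ∀ {n} {r s : Fin n} u v → Unique (u ++ s ∷ r ∷ v) →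
                 map (transpose r s) (u ++ s ∷ r ∷ v) ≡ u ++ r ∷ s ∷ v
transpose-word {r = r} {s} u v uniq = begin
  map t (u ++ s ∷ r ∷ v)         ≡⟨ map-++ t u (s ∷ r ∷ v) ⟩
  map t u ++ t s ∷ t r ∷ map t v ≡⟨ cong₂ (λ x y → map t u ++ x ∷ y ∷ map t v)
                                           (transpose-matchʳ r s) (transpose-matchˡ r s) ⟩
  map t u ++ r ∷ s ∷ map t v     ≡⟨ cong₂ (λ P Q → P ++ r ∷ s ∷ Q)
                                           (fixes u (s∉ ∘′ ∈-++⁺ˡ) (r∉ ∘′ ∈-++⁺ˡ ∘′ ∈-++⁺ˡ))
                                           (fixes v (s∉ ∘′ ∈-++⁺ʳ u ∘′ there)
                                                    (r∉ ∘′ ∈-++⁺ʳ (u ++ [ s ]))) ⟩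
  u ++ r ∷ s ∷ v                 ∎
  where
  t = transpose r s
  s∉ : s ∉ u ++ r ∷ v
  s∉ = ∉-rest u uniq
  r∉ : r ∉ (u ++ [ s ]) ++ v
  r∉ = ∉-rest (u ++ [ s ]) (subst Unique (sym (++-assoc u [ s ] (r ∷ v))) uniq)
  fixes : ∀ L → s ∉ L → r ∉ L → map t L ≡ L
  fixes L s∉L r∉L = map-id-local (All.tabulate λ x∈ →
    transpose-fix (λ x≡r → r∉L (subst (_∈ L) x≡r x∈)) (λ x≡s → s∉L (subst (_∈ L) x≡s x∈)))

step-conjugates : ∀ {n} {r s : Fin n} {σ ρ} → Step r s σ ρ →
                  ∀ x → transpose r s (σ x) ≡ ρ (transpose r s x)
step-conjugates {r = r} {s} {σ} {ρ} (_ , u , v , W↭ , σ≗ , ρ≗) x = sym (begin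
  ρ (t x)                            ≡⟨ ρ≗ (t x) ⟩
  cyc (u ++ r ∷ s ∷ v) (t x)         ≡⟨ cong (λ W → cyc W (t x)) (transpose-word u v uniq) ⟨
  cyc (map t (u ++ s ∷ r ∷ v)) (t x) ≡⟨ cyc-map (transpose-injective r s) (u ++ s ∷ r ∷ v) x ⟩
  t (cyc (u ++ s ∷ r ∷ v) x)         ≡⟨ cong t (σ≗ x) ⟨
  t (σ x)                            ∎)
  where
  t = transpose r s
  uniq = PermWord-unique W↭

-- The inverse major index

-- Letters are 0-based: x contributes x when x − 1 occurs later, which in 1-based
-- terms is the inverse descent x (the letter x + 1 stands before the letter x).
lead : ℕ → List ℕ → ℕ
lead zero    L = 0
lead (suc y) L = if does (y ∈? L) then suc y else 0

imaj : List ℕ → ℕ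
imaj []      = 0
imaj (x ∷ L) = lead x L + imaj L

lead-cong : ∀ x {L L′} → (∀ {y} → x ≡ suc y → y ∈ L ⇔ y ∈ L′) → lead x L ≡ lead x L′
lead-cong zero    _    = refl
lead-cong (suc y) L⇔L′ rewrite does-⇔ (L⇔L′ refl) (y ∈? _) (y ∈? _) = refl

lead-pred∈ : ∀ x {L} → (∀ {y} → x ≡ suc y → y ∈ L) → lead x L ≡ x
lead-pred∈ zero    _  = refl
lead-pred∈ (suc y) y∈ rewrite dec-true (y ∈? _) (y∈ refl) = refl

lead-pred∉ : ∀ {y L} → y ∉ L → lead (suc y) L ≡ 0
lead-pred∉ {y} y∉ rewrite dec-false (y ∈? _) y∉ = refl

∈-∷-⇔ : ∀ {y b : ℕ} {L} → y ≢ b → y ∈ b ∷ L ⇔ y ∈ L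
∈-∷-⇔ y≢b = mk⇔ (λ { (here y≡b) → ⊥-elim (y≢b y≡b) ; (there y∈) → y∈ }) there

∈-∷ʳ-⇔ : ∀ {y r : ℕ} L → y ≢ r → y ∈ L ++ [ r ] ⇔ y ∈ L
∈-∷ʳ-⇔ L y≢r =
  mk⇔ (λ y∈ → [ (λ y∈L → y∈L) , (λ { (here y≡r) → ⊥-elim (y≢r y≡r) }) ]′ (∈-++⁻ L y∈))
      ∈-++⁺ˡ

imaj-swap : ∀ P {a b} Q → a ≢ suc b → b ≢ suc a → imaj (P ++ a ∷ b ∷ Q) ≡ imaj (P ++ b ∷ a ∷ Q)
imaj-swap [] {a} {b} Q a≢1+b b≢1+a =
  trans (cong₂ (λ p q → p + (q + imaj Q))
          (lead-cong a (λ { refl → ∈-∷-⇔ (a≢1+b ∘′ cong suc) }))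
          (sym (lead-cong b (λ { refl → ∈-∷-⇔ (b≢1+a ∘′ cong suc) }))))
        (x∙yz≈y∙xz (lead a Q) (lead b (a ∷ Q)) (imaj Q))
imaj-swap (x ∷ P) Q a≢1+b b≢1+a =
  cong₂ _+_ (lead-cong x (λ _ → mk⇔ (∈-resp-↭ swapped) (∈-resp-↭ (↭-sym swapped))))
            (imaj-swap P Q a≢1+b b≢1+a)
  where swapped = ++⁺ˡ P (swap _ _ ↭-refl)

imaj-∷ʳ-absent : ∀ L {r} → suc r ∉ L → imaj (L ++ [ r ]) ≡ imaj L
imaj-∷ʳ-absent []      {zero}  _    = refl
imaj-∷ʳ-absent []      {suc r} _    = refl
imaj-∷ʳ-absent (x ∷ L)         1+r∉ =
  cong₂ _+_ (lead-cong x (λ { refl → ∈-∷ʳ-⇔ L (λ y≡r → 1+r∉ (here (cong suc (sym y≡r)))) }))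
            (imaj-∷ʳ-absent L (1+r∉ ∘′ there))

imaj-∷ʳ-present : ∀ L {r} → Unique L → r ∉ L → suc r ∈ L → imaj (L ++ [ r ]) ≡ suc r + imaj L
imaj-∷ʳ-present (x ∷ L) {r} (x∉ ∷ _) r∉ (here refl) =
  cong₂ _+_ (lead-pred∈ (suc r) (λ { refl → ∈-++⁺ʳ L (here refl) }))
            (trans (imaj-∷ʳ-absent L (λ 1+r∈ → All.lookup x∉ 1+r∈ refl))
                   (cong (_+ imaj L) (sym (lead-pred∉ (r∉ ∘′ there)))))
imaj-∷ʳ-present (x ∷ L) {r} (x∉ ∷ L!) r∉ (there 1+r∈) =
  trans (cong₂ _+_ (lead-cong x (λ { refl → ∈-∷ʳ-⇔ L (λ { refl → All.lookup x∉ 1+r∈ refl }) }))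
                   (imaj-∷ʳ-present L L! (r∉ ∘′ there) 1+r∈))
        (x∙yz≈y∙xz (lead x L) (suc r) (imaj L))

imaj-rotate : ∀ L {r} → Unique L → r ∉ L → suc r ∈ L → (∀ {j} → r ≡ suc j → j ∈ L) →
              imaj (L ++ [ r ]) ≡ suc (imaj (r ∷ L))
imaj-rotate L {r} L! r∉ 1+r∈ pred∈ =
  trans (imaj-∷ʳ-present L L! r∉ 1+r∈) (cong (λ c → suc (c + imaj L)) (sym (lead-pred∈ r pred∈)))

imaj-increasing : ∀ {L} → AllPairs _<_ L → imaj L ≡ 0
imaj-increasing []                = refl
imaj-increasing {x ∷ L} (x< ∷ L<) = trans (cong (_+ imaj L) (no-lead x x<)) (imaj-increasing L<)
  where
  no-lead : ∀ x → All (x <_) L → lead x L ≡ 0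
  no-lead zero    _  = refl
  no-lead (suc y) x< = lead-pred∉ (λ y∈ → ℕ.<-asym (ℕ.n<1+n y) (All.lookup x< y∈))

C2-suc : ∀ j → suc j C 2 ≡ j + j C 2
C2-suc j = sym (trans (cong (_+ j C 2) (sym (nC1≡n j))) (nCk+nC[k+1]≡[n+1]C[k+1] j 1))

imaj-downFrom : ∀ m → imaj (downFrom m) ≡ m C 2
imaj-downFrom zero    = refl
imaj-downFrom (suc m) =
  trans (cong₂ _+_ (lead-pred∈ m (λ { refl → ∈-downFrom⁺ (ℕ.n<1+n _) })) (imaj-downFrom m))
        (sym (C2-suc m))

C2-double : ∀ j → (j C 2) * 2 + j ≡ j * j
C2-double zero    = refl
C2-double (suc j) = begin
  (suc j C 2) * 2 + suc j         ≡⟨ cong (λ c → c * 2 + suc j) (C2-suc j) ⟩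
  (j + j C 2) * 2 + suc j         ≡⟨ regroup j (j C 2) ⟩
  ((j C 2) * 2 + j) + (j + suc j) ≡⟨ cong (_+ (j + suc j)) (C2-double j) ⟩
  j * j + (j + suc j)             ≡⟨ square j ⟩
  suc j * suc j                   ∎
  where
  regroup : ∀ j c → (j + c) * 2 + suc j ≡ (c * 2 + j) + (j + suc j)
  regroup = solve-∀
  square : ∀ j → j * j + (j + suc j) ≡ suc j * suc j
  square = solve-∀

C2-unique : ∀ j c → c * 2 + j ≡ j * j → j C 2 ≡ c
C2-unique j c eq = ℕ.*-cancelʳ-≡ (j C 2) c 2 (ℕ.+-cancelʳ-≡ j _ _ (trans (C2-double j) (sym eq)))

-- The statistic along covering steps

module _ {m : ℕ} where

  top : Fin (suc m)
  top = fromℕ m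

  cycleImaj : (Fin (suc m) → Fin (suc m)) → ℕ
  cycleImaj σ = imaj (map toℕ (orbit σ m top))

  cycleImaj-read : ∀ {σ W} → PermWord W → (∀ i → σ i ≡ cyc W i) →
                   ∀ P Q → W ≡ P ++ top ∷ Q → cycleImaj σ ≡ imaj (map toℕ (Q ++ P))
  cycleImaj-read {σ} {W} W↭ σ≗ P Q eq =
    cong (imaj ∘ map toℕ)
      (trans (cong (λ k → orbit σ k top) m≡) (orbit-rotation (PermWord-cycleWord W↭ σ≗) P Q eq))
    where
    m≡ : m ≡ length Q + length P
    m≡ = ℕ.suc-injective (begin
      suc m                     ≡⟨ PermWord-length W↭ ⟨
      length W                  ≡⟨ cong length eq ⟩
      length (P ++ top ∷ Q)     ≡⟨ length-++ P ⟩
      length P + suc (length Q) ≡⟨ ℕ.+-comm (length P) _ ⟩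
      suc (length Q + length P) ∎)

  imaj-swap-toℕ : ∀ P {r s : Fin (suc m)} Q → suc (toℕ r) < toℕ s →
                  imaj (map toℕ (P ++ r ∷ s ∷ Q)) ≡ imaj (map toℕ (P ++ s ∷ r ∷ Q))
  imaj-swap-toℕ P {r} {s} Q 1+r<s rewrite map-++ toℕ P (r ∷ s ∷ Q) | map-++ toℕ P (s ∷ r ∷ Q) =
    imaj-swap (map toℕ P) (map toℕ Q) r≢1+s (ℕ.<⇒≢ 1+r<s ∘′ sym)
    where
    r≢1+s : toℕ r ≢ suc (toℕ s)
    r≢1+s r≡1+s = ℕ.<-asym 1+r<s (subst (toℕ s <_) (cong suc (sym r≡1+s)) (ℕ.m<n⇒m<1+n (ℕ.n<1+n _)))

  step-r≢top : ∀ {r s σ ρ} → Step r s σ ρ → r ≢ top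
  step-r≢top {r} {s} (1+r<s , _) r≡top = ℕ.<⇒≢ r<m (trans (cong toℕ r≡top) (toℕ-fromℕ m))
    where
    r<m : toℕ r < m
    r<m = ℕ.<-≤-trans (ℕ.<-trans (ℕ.n<1+n _) 1+r<s) (ℕ.m<1+n⇒m≤n (toℕ<n s))

  step-σ-top : ∀ {r σ ρ} → Step r top σ ρ → σ top ≡ r
  step-σ-top (_ , u , v , W↭ , σ≗ , _) = cycleWord-next (PermWord-cycleWord W↭ σ≗) u v refl

  PermWord-others : ∀ {r} u v → PermWord (u ++ top ∷ r ∷ v) →
                    ∀ {j} → j < m → j ≢ toℕ r → j ∈ map toℕ (v ++ u)
  PermWord-others {r} u v W↭ {j} j<m j≢r
    with ∈-resp-↭ (++-comm u (top ∷ r ∷ v)) (PermWord-∈ W↭ (fromℕ< (ℕ.m<n⇒m<1+n j<m)))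
  ... | here c≡top =
    ⊥-elim (ℕ.<⇒≢ j<m (trans (sym (toℕ-fromℕ< _)) (trans (cong toℕ c≡top) (toℕ-fromℕ m))))
  ... | there (here c≡r) = ⊥-elim (j≢r (trans (sym (toℕ-fromℕ< _)) (cong toℕ c≡r)))
  ... | there (there c∈) = subst (_∈ _) (toℕ-fromℕ< _) (∈-map⁺ toℕ c∈)

  cycleImaj-step-top : ∀ {r σ ρ} → Step r top σ ρ → cycleImaj ρ ≡ suc (cycleImaj σ)
  cycleImaj-step-top {r} {σ} {ρ} (1+r<top , u , v , W↭ , σ≗ , ρ≗) = begin
    cycleImaj ρ                      ≡⟨ cycleImaj-read (PermWord-swap u v W↭) ρ≗ (u ++ [ r ]) v
                                          (sym (++-assoc u [ r ] (top ∷ v))) ⟩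
    imaj (map toℕ (v ++ u ++ [ r ])) ≡⟨ cong imaj (trans (cong (map toℕ) (sym (++-assoc v u [ r ])))
                                                          (map-++ toℕ (v ++ u) [ r ])) ⟩
    imaj (L ++ [ toℕ r ])            ≡⟨ imaj-rotate L L! r∉ (others 1+r<m ℕ.1+n≢n) pred∈ ⟩
    suc (imaj (toℕ r ∷ L))           ≡⟨ cong suc (cycleImaj-read W↭ σ≗ u (r ∷ v) refl) ⟨
    suc (cycleImaj σ)                ∎
    where
    L = map toℕ (v ++ u)
    others = PermWord-others u v W↭
    1+r<m : suc (toℕ r) < m
    1+r<m = subst (suc (toℕ r) <_) (toℕ-fromℕ m) 1+r<top
    rL! : Unique (toℕ r ∷ L)
    rL! with Unique-resp-↭ (++-comm u (top ∷ r ∷ v)) (PermWord-unique W↭)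
    ... | _ ∷ rvu! = Unique.map⁺ toℕ-injective rvu!
    L! : Unique L
    L! with rL!
    ... | _ ∷ L! = L!
    r∉ : toℕ r ∉ L
    r∉ with rL!
    ... | r∉ ∷ _ = λ r∈ → All.lookup r∉ r∈ refl
    pred∈ : ∀ {j} → toℕ r ≡ suc j → j ∈ L
    pred∈ {j} r≡1+j =
      others (ℕ.<-trans (subst (j <_) (sym r≡1+j) (ℕ.n<1+n j)) (ℕ.<-trans (ℕ.n<1+n _) 1+r<m))
             (λ j≡r → ℕ.1+n≢n (sym (trans j≡r r≡1+j)))

  cycleImaj-step-other : ∀ {r s σ ρ} → s ≢ top → Step r s σ ρ → cycleImaj ρ ≡ cycleImaj σ
  cycleImaj-step-other {r} {s} {σ} {ρ} s≢top st@(1+r<s , u , v , W↭ , σ≗ , ρ≗)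
    with ∈-++⁻ u (PermWord-∈ W↭ top)
  ... | inj₂ (here top≡s)         = ⊥-elim (s≢top (sym top≡s))
  ... | inj₂ (there (here top≡r)) = ⊥-elim (step-r≢top st (sym top≡r))
  ... | inj₁ top∈u with ∈-∃++ top∈u
  ...   | u₁ , u₂ , refl = begin
    cycleImaj ρ
      ≡⟨ cycleImaj-read (PermWord-swap u v W↭) ρ≗ u₁ (u₂ ++ r ∷ s ∷ v) (++-assoc u₁ (top ∷ u₂) _) ⟩
    imaj (map toℕ ((u₂ ++ r ∷ s ∷ v) ++ u₁))
      ≡⟨ cong (imaj ∘ map toℕ) (++-assoc u₂ (r ∷ s ∷ v) u₁) ⟩
    imaj (map toℕ (u₂ ++ r ∷ s ∷ v ++ u₁))
      ≡⟨ imaj-swap-toℕ u₂ (v ++ u₁) 1+r<s ⟩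
    imaj (map toℕ (u₂ ++ s ∷ r ∷ v ++ u₁))
      ≡⟨ cong (imaj ∘ map toℕ) (++-assoc u₂ (s ∷ r ∷ v) u₁) ⟨
    imaj (map toℕ ((u₂ ++ s ∷ r ∷ v) ++ u₁))
      ≡⟨ cycleImaj-read W↭ σ≗ u₁ (u₂ ++ s ∷ r ∷ v) (++-assoc u₁ (top ∷ u₂) _) ⟨
    cycleImaj σ ∎
  cycleImaj-step-other {r} {s} {σ} {ρ} s≢top (1+r<s , u , v , W↭ , σ≗ , ρ≗)
    | inj₂ (there (there top∈v)) with ∈-∃++ top∈v
  ... | v₁ , v₂ , refl = begin
    cycleImaj ρ
      ≡⟨ cycleImaj-read (PermWord-swap u _ W↭) ρ≗ (u ++ r ∷ s ∷ v₁) v₂ (sym (++-assoc u (r ∷ s ∷ v₁) _)) ⟩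
    imaj (map toℕ (v₂ ++ u ++ r ∷ s ∷ v₁))
      ≡⟨ cong (imaj ∘ map toℕ) (++-assoc v₂ u (r ∷ s ∷ v₁)) ⟨
    imaj (map toℕ ((v₂ ++ u) ++ r ∷ s ∷ v₁))
      ≡⟨ imaj-swap-toℕ (v₂ ++ u) v₁ 1+r<s ⟩
    imaj (map toℕ ((v₂ ++ u) ++ s ∷ r ∷ v₁))
      ≡⟨ cong (imaj ∘ map toℕ) (++-assoc v₂ u (s ∷ r ∷ v₁)) ⟩
    imaj (map toℕ (v₂ ++ u ++ s ∷ r ∷ v₁))
      ≡⟨ cycleImaj-read W↭ σ≗ (u ++ s ∷ r ∷ v₁) v₂ (sym (++-assoc u (s ∷ r ∷ v₁) _)) ⟨
    cycleImaj σ ∎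

-- Independence of the path

  record CanonicalConjugator (σ τ α : Fin (suc m) → Fin (suc m)) : Set where
    field
      conjugates : ∀ x → α (σ x) ≡ τ (α x)
      exponent   : ℕ
      imaj-gap   : cycleImaj σ + exponent ≡ cycleImaj τ
      anchor     : α (iterate σ top exponent) ≡ top

  canonical-step : ∀ {r s σ ρ τ α} → Step r s σ ρ → CanonicalConjugator ρ τ α →
                   CanonicalConjugator σ τ (α ∘ transpose r s)
  canonical-step {r} {s} {σ} {ρ} {τ} {α} st c = by-cases (s ≟ top)
    where
    open CanonicalConjugator c
    t = transpose r s
    conjugates′ : ∀ x → α (t (σ x)) ≡ τ (α (t x))
    conjugates′ x = trans (cong α (step-conjugates st x)) (conjugates (t x))
    moved : ∀ x k → t (iterate σ x k) ≡ iterate ρ (t x) k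
    moved x k = sym (iterate-conj (step-conjugates st) k x)
    by-cases : Dec (s ≡ top) → CanonicalConjugator σ τ (α ∘ t)
    by-cases (yes refl) = record
      { conjugates = conjugates′
      ; exponent   = suc exponent
      ; imaj-gap   = trans (ℕ.+-suc _ exponent)
                             (trans (cong (_+ exponent) (sym (cycleImaj-step-top st))) imaj-gap)
      ; anchor     = begin
          α (t (iterate σ (σ top) exponent)) ≡⟨ cong (λ x → α (t (iterate σ x exponent))) (step-σ-top st) ⟩
          α (t (iterate σ r exponent))       ≡⟨ cong α (moved r exponent) ⟩
          α (iterate ρ (t r) exponent)       ≡⟨ cong (λ x → α (iterate ρ x exponent))
                                                  (transpose-matchˡ r s) ⟩
          α (iterate ρ top exponent)         ≡⟨ anchor ⟩
          top                                ∎
      }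
    by-cases (no s≢top) = record
      { conjugates = conjugates′
      ; exponent   = exponent
      ; imaj-gap   = trans (cong (_+ exponent) (sym (cycleImaj-step-other s≢top st))) imaj-gap
      ; anchor     = begin
          α (t (iterate σ top exponent))     ≡⟨ cong α (moved top exponent) ⟩
          α (iterate ρ (t top) exponent)     ≡⟨ cong (λ x → α (iterate ρ x exponent))
                                                  (transpose-fix (step-r≢top st ∘′ sym) (s≢top ∘′ sym)) ⟩
          α (iterate ρ top exponent)         ≡⟨ anchor ⟩
          top                                ∎
      }

  alpha-canonical : ∀ {σ τ} (p : Path σ τ) → CanonicalConjugator σ τ (alpha p)
  alpha-canonical []              =
    record { conjugates = λ _ → refl ; exponent = 0 ; imaj-gap = ℕ.+-identityʳ _ ; anchor = refl }
  alpha-canonical (step r s st p) = canonical-step st (alpha-canonical p)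

  conjugators-agree : ∀ {σ τ α β : Fin (suc m) → Fin (suc m)} →
                      (∀ x → α (σ x) ≡ τ (α x)) → (∀ x → β (σ x) ≡ τ (β x)) →
                      ∀ {x} → α x ≡ β x → ∀ j → α (iterate σ x j) ≡ β (iterate σ x j)
  conjugators-agree {τ = τ} α-conj β-conj {x} αx≡βx j =
    trans (sym (iterate-conj α-conj j x)) (trans (cong (λ y → iterate τ y j) αx≡βx) (iterate-conj β-conj j x))

  canonical-unique : ∀ {σ τ α β W} → PermWord W → (∀ i → σ i ≡ cyc W i) →
                     CanonicalConjugator σ τ α → CanonicalConjugator σ τ β → ∀ y → α y ≡ β y
  canonical-unique {σ} {τ} {α} {β} W↭ σ≗ cα cβ y
    with iterate-reaches (PermWord-cycleWord W↭ σ≗)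
           (PermWord-∈ W↭ (iterate σ top (CanonicalConjugator.exponent cα))) (PermWord-∈ W↭ y)
  ... | j , refl = conjugators-agree {σ} {τ} {α} {β} (conjugates cα) (conjugates cβ) anchors-agree j
    where
    open CanonicalConjugator
    same-exponent : exponent cα ≡ exponent cβ
    same-exponent = ℕ.+-cancelˡ-≡ (cycleImaj σ) _ _ (trans (imaj-gap cα) (sym (imaj-gap cβ)))
    anchors-agree : α (iterate σ top (exponent cα)) ≡ β (iterate σ top (exponent cα))
    anchors-agree =
      trans (anchor cα) (sym (subst (λ k → β (iterate σ top k) ≡ top) (sym same-exponent) (anchor cβ)))

  alpha-path-independent : ∀ {σ τ} (p q : Path σ τ) → ∀ i → alpha p i ≡ alpha q i
  alpha-path-independent []  [] i = refl
  alpha-path-independent p@(step _ _ (_ , _ , _ , W↭ , σ≗ , _) _) q =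
    canonical-unique W↭ σ≗ (alpha-canonical p) (alpha-canonical q)
  alpha-path-independent p@[] q@(step _ _ (_ , _ , _ , W↭ , σ≗ , _) _) =
    canonical-unique W↭ σ≗ (alpha-canonical p) (alpha-canonical q)

-- The maximal path

  σ₀ τ₀ : Fin (suc m) → Fin (suc m)
  σ₀ = cyc (allFin (suc m))
  τ₀ = cyc (reverse (allFin (suc m)))

  belowTop : List (Fin (suc m))
  belowTop = tabulate inject₁

  allFin-∷ʳ : allFin (suc m) ≡ belowTop ∷ʳ top
  allFin-∷ʳ = tabulate-∷ʳ (λ i → i)

  reverse-allFin : reverse (allFin (suc m)) ≡ top ∷ reverse belowTop
  reverse-allFin = trans (cong reverse allFin-∷ʳ) (reverse-++ belowTop [ top ])

  toℕ-belowTop : map toℕ belowTop ≡ upTo m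
  toℕ-belowTop =
    trans (map-tabulate inject₁ toℕ) (trans (tabulate-cong toℕ-inject₁) (tabulate-toℕ (λ i → i) m))

  σ₀-word : CycleWord σ₀ (allFin (suc m))
  σ₀-word = PermWord-cycleWord ↭-refl (λ _ → refl)

  τ₀-word : CycleWord τ₀ (reverse (allFin (suc m)))
  τ₀-word = PermWord-cycleWord (↭-reverse (allFin (suc m))) (λ _ → refl)

  cycleImaj-σ₀ : cycleImaj σ₀ ≡ 0
  cycleImaj-σ₀ = begin
    cycleImaj σ₀            ≡⟨ cycleImaj-read ↭-refl (λ _ → refl) belowTop [] allFin-∷ʳ ⟩
    imaj (map toℕ belowTop) ≡⟨ cong imaj toℕ-belowTop ⟩
    imaj (upTo m)           ≡⟨ imaj-increasing (applyUpTo⁺₁ (λ i → i) m (λ i<j _ → i<j)) ⟩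
    0                       ∎

  cycleImaj-τ₀ : cycleImaj τ₀ ≡ m C 2
  cycleImaj-τ₀ = begin
    cycleImaj τ₀                            ≡⟨ cycleImaj-read (↭-reverse (allFin (suc m))) (λ _ → refl)
                                                 [] (reverse belowTop) reverse-allFin ⟩
    imaj (map toℕ (reverse belowTop ++ [])) ≡⟨ cong (imaj ∘ map toℕ) (++-identityʳ (reverse belowTop)) ⟩
    imaj (map toℕ (reverse belowTop))       ≡⟨ cong imaj (reverse-map toℕ belowTop) ⟩
    imaj (reverse (map toℕ belowTop))       ≡⟨ cong (imaj ∘ reverse) toℕ-belowTop ⟩
    imaj (reverse (upTo m))                 ≡⟨ cong imaj (reverse-upTo m) ⟩
    imaj (downFrom m)                       ≡⟨ imaj-downFrom m ⟩
    m C 2                                   ∎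

  τ₀-orbit : orbit τ₀ m top ≡ reverse belowTop
  τ₀-orbit = subst (λ k → orbit τ₀ k top ≡ reverse belowTop)
                   (trans (length-reverse belowTop) (length-tabulate inject₁))
                   (orbit-from τ₀-word (reverse belowTop) reverse-allFin)

  σ₀-top : σ₀ top ≡ zero
  σ₀-top = cycleWord-wrap σ₀-word _ belowTop refl allFin-∷ʳ

  σ₀-period : ∀ q → iterate σ₀ zero (q * suc m) ≡ zero
  σ₀-period zero    = refl
  σ₀-period (suc q) = begin
    iterate σ₀ zero (suc m + q * suc m)              ≡⟨ iterate-+ σ₀ zero (suc m) (q * suc m) ⟩
    iterate σ₀ (iterate σ₀ zero (suc m)) (q * suc m) ≡⟨ cong (λ x → iterate σ₀ x (q * suc m)) one-turn ⟩
    iterate σ₀ zero (q * suc m)                      ≡⟨ σ₀-period q ⟩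
    zero                                             ∎
    where
    one-turn : iterate σ₀ zero (suc m) ≡ zero
    one-turn = subst (λ k → iterate σ₀ zero (suc k) ≡ zero) (length-tabulate {n = m} suc)
                     (iterate-period σ₀-word _ refl)

  σ₀-iterate-top : ∀ q a → iterate σ₀ top (suc (q * suc m + a)) ≡ iterate σ₀ zero a
  σ₀-iterate-top q a = begin
    iterate σ₀ (σ₀ top) (q * suc m + a)        ≡⟨ cong (λ x → iterate σ₀ x (q * suc m + a)) σ₀-top ⟩
    iterate σ₀ zero (q * suc m + a)            ≡⟨ iterate-+ σ₀ zero (q * suc m) a ⟩
    iterate σ₀ (iterate σ₀ zero (q * suc m)) a ≡⟨ cong (λ x → iterate σ₀ x a) (σ₀-period q) ⟩
    iterate σ₀ zero a                          ∎

  conjugator-word : ∀ {α} → (∀ x → α (σ₀ x) ≡ τ₀ (α x)) →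
                    ∀ P {x₀} Q → allFin (suc m) ≡ P ++ x₀ ∷ Q → α x₀ ≡ top →
                    map (suc ∘ toℕ ∘ α) (P ++ x₀ ∷ Q) ≡
                    applyDownFrom suc (length P) ++ applyDownFrom (λ i → length P + suc i) (suc (length Q))
  conjugator-word {α} α-conj P {x₀} Q split αx₀≡top =
    trans (map-++ f P (x₀ ∷ Q)) (cong₂ _++_ (proj₂ halves) (proj₁ halves))
    where
    f = suc ∘ toℕ ∘ α
    K = length Q + length P
    size : suc (length Q) + length P ≡ suc m
    size = trans (ℕ.+-comm (suc (length Q)) (length P))
                 (trans (sym (length-++ P)) (trans (cong length (sym split)) (length-tabulate (λ i → i))))
    rotated : map α (x₀ ∷ Q ++ P) ≡ reverse (allFin (suc m))
    rotated = begin
      map α (x₀ ∷ Q ++ P)          ≡⟨ cong ((α x₀ ∷_) ∘ map α) (orbit-rotation σ₀-word P Q split) ⟨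
      α x₀ ∷ map α (orbit σ₀ K x₀) ≡⟨ cong (α x₀ ∷_) (orbit-conj α-conj K x₀) ⟩
      α x₀ ∷ orbit τ₀ K (α x₀)     ≡⟨ cong (λ y → y ∷ orbit τ₀ K y) αx₀≡top ⟩
      top ∷ orbit τ₀ K top         ≡⟨ cong (λ k → top ∷ orbit τ₀ k top) (ℕ.suc-injective size) ⟩
      top ∷ orbit τ₀ m top         ≡⟨ cong (top ∷_) τ₀-orbit ⟩
      top ∷ reverse belowTop       ≡⟨ reverse-allFin ⟨
      reverse (allFin (suc m))     ∎
    values : map f (x₀ ∷ Q) ++ map f P ≡
             applyDownFrom (λ i → length P + suc i) (suc (length Q)) ++ applyDownFrom suc (length P)
    values = begin
      map f (x₀ ∷ Q) ++ map f P                     ≡⟨ map-++ f (x₀ ∷ Q) P ⟨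
      map f (x₀ ∷ Q ++ P)                           ≡⟨ map-∘ (x₀ ∷ Q ++ P) ⟩
      map (suc ∘ toℕ) (map α (x₀ ∷ Q ++ P))         ≡⟨ cong (map (suc ∘ toℕ)) rotated ⟩
      map (suc ∘ toℕ) (reverse (allFin (suc m)))    ≡⟨ map-reverse-allFin suc (suc m) ⟩
      applyDownFrom suc (suc m)                     ≡⟨ cong (applyDownFrom suc) size ⟨
      applyDownFrom suc (suc (length Q) + length P) ≡⟨ applyDownFrom-+ (length P) (suc (length Q)) ⟩
      applyDownFrom (λ i → length P + suc i) (suc (length Q)) ++ applyDownFrom suc (length P) ∎
    halves = ++-injective-length (map f (x₀ ∷ Q)) _
               (trans (length-map f (x₀ ∷ Q)) (sym (length-applyDownFrom _ (suc (length Q))))) values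

  maximal-path-word : (p : Path σ₀ τ₀) → ∀ q a b → a + suc b ≡ suc m → m C 2 ≡ suc (q * suc m + a) →
                      alphaWord p ≡ applyDownFrom suc a ++ applyDownFrom (λ i → a + suc i) (suc b)
  maximal-path-word p q a b size C2≡
    with splitAt-length (allFin (suc m)) a b (trans (length-tabulate (λ i → i)) (sym size))
  ... | P , x₀ , Q , split , refl , refl =
    trans (cong (map (suc ∘ toℕ ∘ alpha p)) split) (conjugator-word conjugates P Q split anchored)
    where
    open CanonicalConjugator (alpha-canonical p)
    exponent≡ : exponent ≡ suc (q * suc m + length P)
    exponent≡ = trans (trans (cong (_+ exponent) (sym cycleImaj-σ₀)) (trans imaj-gap cycleImaj-τ₀)) C2≡
    anchored : alpha p x₀ ≡ top
    anchored = begin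
      alpha p x₀
        ≡⟨ cong (alpha p) (iterate-position σ₀-word _ P Q refl split) ⟨
      alpha p (iterate σ₀ zero (length P))
        ≡⟨ cong (alpha p) (σ₀-iterate-top q (length P)) ⟨
      alpha p (iterate σ₀ top (suc (q * suc m + length P)))
        ≡⟨ cong (alpha p ∘ iterate σ₀ top) exponent≡ ⟨
      alpha p (iterate σ₀ top exponent)
        ≡⟨ anchor ⟩
      top ∎

odd-exponent : ∀ q {m} → m ≡ 2 * suc q → m C 2 ≡ suc (q * suc m + 0)
odd-exponent q refl = C2-unique _ _ (identity q)
  where
  identity : ∀ q → suc (q * suc (2 * suc q) + 0) * 2 + 2 * suc q ≡ 2 * suc q * (2 * suc q)
  identity = solve-∀

even-exponent : ∀ c {m} → suc m ≡ 2 * suc (suc c) → m C 2 ≡ suc (c * suc m + suc (suc c))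
even-exponent c {m} n≡ =
  subst (λ k → k C 2 ≡ suc (c * suc k + suc (suc c))) (sym m≡) (C2-unique _ _ (identity c))
  where
  double : ∀ c → 2 * suc (suc c) ≡ suc (3 + 2 * c)
  double = solve-∀
  m≡ : m ≡ 3 + 2 * c
  m≡ = ℕ.suc-injective (trans n≡ (double c))
  identity : ∀ c → suc (c * suc (3 + 2 * c) + suc (suc c)) * 2 + (3 + 2 * c) ≡ (3 + 2 * c) * (3 + 2 * c)
  identity = solve-∀

proposition2p6 : (n : ℕ) → 3 ≤ n →
    ((σ τ : Fin n → Fin n) (p q : Path σ τ) → ∀ i → alpha p i ≡ alpha q i)
    × ((p : Path (cyc (allFin n)) (cyc (reverse (allFin n)))) →
        (∀ m → n ≡ suc (2 * m) → alphaWord p ≡ applyDownFrom suc n)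
        × (∀ m → n ≡ 2 * m →
             alphaWord p ≡ applyDownFrom suc m ++ applyDownFrom (λ i → m + suc i) m))
proposition2p6 (suc m@(suc (suc _))) (s≤s (s≤s (s≤s _))) =
  (λ _ _ → alpha-path-independent) , λ p → odd p , even p
  where
  odd : (p : Path σ₀ τ₀) → ∀ M → suc m ≡ suc (2 * M) → alphaWord p ≡ applyDownFrom suc (suc m)
  odd p zero    ()
  odd p (suc q) n≡ = maximal-path-word p q 0 m refl (odd-exponent q (ℕ.suc-injective n≡))
  even : (p : Path σ₀ τ₀) → ∀ M → suc m ≡ 2 * M →
         alphaWord p ≡ applyDownFrom suc M ++ applyDownFrom (λ i → M + suc i) M
  even p zero          ()
  even p (suc zero)    ()
  even p (suc (suc c)) n≡ =
    maximal-path-word p c (suc (suc c)) (suc c)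
      (trans (cong (suc (suc c) +_) (sym (ℕ.+-identityʳ _))) (sym n≡)) (even-exponent c n≡)
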